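{- Let $s\ge 5$ and $m\ge 1$ be integers, $n=sm+s-2$, let $\mathcal F\subset 2^{[n]}$ satisfy $\nu(\mathcal F)<s$, and let $\sigma$ be any permutation of $[n]$. For $1\le i\le n$ let $D_i=\{\sigma(i),\sigma(i+1),\dots,\sigma(i+m-1)\}$, indices taken modulo $n$ (in $\{1,\dots,n\}$). For $0\le i\le s$ let $x_i$ be the number of $j\in[n]$ such that exactly $i$ of the $s$ sets $D_j,D_{j+m},\dots,D_{j+(s-1)m}$ (indices modulo $n$) are not members of $\mathcal F$. Then $$x_1+\sum_{i=1}^{s-2}\bigl(i-\tfrac32\bigr)x_i+x_s\ge s-2.$$
   Context: Members $F_1,\dots,F_s$ of $\mathcal F$ are pairwise disjoint if $F_i\cap F_j=\emptyset$ for $i\neq j$ (they may coincide only if empty); $\nu(\mathcal F)$ is the maximum number of pairwise disjoint members. -}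

module Defs where

open import Data.Nat using (ℕ; zero; suc; _+_; _*_; _≡ᵇ_)
open import Data.Nat.DivMod using (_mod_)
open import Data.Bool using (Bool; true; false; if_then_else_)
open import Data.Fin using (Fin; toℕ)
open import Data.Fin.Properties using (_≟_)
open import Data.Fin.Subset using (Subset; _∩_; ⊥; inside; outside)
open import Data.Fin.Permutation using (Permutation′; _⟨$⟩ʳ_)
open import Data.List using (List; map; upTo; allFin)
open import Data.Bool.ListAction using (any)
open import Data.Nat.ListAction using (sum)
open import Data.Vec using (tabulate)
open import Data.Product using (Σ; _×_)
open import Relation.Nullary using (¬_; does)
open import Relation.Binary.PropositionalEquality using (_≡_; _≢_)

Family : ℕ → Set
Family n = Subset n → Bool

-- ν(𝓕) < s : there are no s pairwise disjoint members of 𝓕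
-- (members indexed by Fin s; they may coincide only if empty, which is
-- automatic from F i ∩ F j = ∅ for i ≠ j).
νLessThan : ∀ {n} → Family n → ℕ → Set
νLessThan {n} 𝓕 s =
  ¬ (Σ (Fin s → Subset n) λ F →
       (∀ i → 𝓕 (F i) ≡ true) × (∀ i j → i ≢ j → F i ∩ F j ≡ ⊥))

-- (j + k) modulo n, for j ∈ Fin n (0-indexed version of [n]).
shift : ∀ {n} → Fin n → ℕ → Fin n
shift {suc n} j k = (toℕ j + k) mod (suc n)

D : ∀ {n} → Permutation′ n → ℕ → Fin n → Subset n
D σ m j = tabulate λ x →
  if any (λ k → does ((σ ⟨$⟩ʳ shift j k) ≟ x)) (upTo m) then inside else outside

missCount : ∀ {n} → Family n → Permutation′ n → ℕ → ℕ → Fin n → ℕ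
missCount 𝓕 σ s m j =
  sum (map (λ t → if 𝓕 (D σ m (shift j (t * m))) then 0 else 1) (upTo s))

xcount : ∀ {n} → Family n → Permutation′ n → ℕ → ℕ → ℕ → ℕ
xcount {n} 𝓕 σ s m i =
  sum (map (λ j → if missCount 𝓕 σ s m j ≡ᵇ i then 1 else 0) (allFin n))

-- For j ∈ [n] let M j be the number of the s sets D_j, D_{j+m}, …, D_{j+(s−1)m} that are not
-- in 𝓕.  Since n ≥ sm these sets are pairwise disjoint, so ν(𝓕) < s gives M j ≥ 1.  Twice the
-- left-hand side is ∑_j w(M j) for the weight w(1) = 1, w(c) = 2c − 3 for 2 ≤ c ≤ s − 2,
-- w(s − 1) = 0, w(s) = 2, so it suffices to show ∑_j w(M j) ≥ 2s − 4.
-- Fix j and follow the walk k ↦ M (j + km): it has period n and moves by at most one per step.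
-- If it goes below s − 2, then either it never rises above s − 2, and all n ≥ 2s − 4 terms are
-- at least 1, or it passes through s − 2 twice, contributing 2(2s − 7) ≥ 2s − 4.  If it stays in
-- {s − 2, s − 1, s}, its sum is s times the number of missing sets met along the walk; as
-- n ≡ −2 (mod s), 2s then divides 4 + 5h + ∑w, where h counts the visits to s − 2, and this
-- forces ∑w ≥ 2s − 4.  The n walks together visit every position n times, so averaging them
-- bounds ∑_j w(M j).
module Submission where

open import Defs
open import Data.Nat using (ℕ; zero; suc; _+_; _*_; _∸_; _≤_; _<_; z≤n; s≤s; _≡ᵇ_; NonZero; >-nonZero; _%_)
import Data.Nat as ℕ
open import Data.Nat.Properties
open import Data.Nat.DivMod using (_mod_; [m+n]%n≡m%n; m%n<n; %-distribˡ-+; m%n%n≡m%n; m≡m%n+[m/n]*n)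
open import Data.Nat.Divisibility using (_∣_; divides; ∣m+n∣m⇒∣n; n∣m*n; ∣⇒≤; m∣n⇒n≡quotient*m; quotient>1)
open import Data.Nat.ListAction using (sum)
open import Data.Nat.Tactic.RingSolver using (solve-∀)
open import Algebra.Properties.CommutativeSemigroup +-commutativeSemigroup
  using (interchange; xy∙z≈xz∙y; xy∙z≈x∙zy; x∙yz≈xz∙y)
open import Data.Bool using (true; false; if_then_else_)
open import Data.Bool.Properties using (T-≡)
open import Data.Bool.ListAction using (any)
open import Data.Empty using (⊥-elim)
open import Data.Product using (∃-syntax; _×_; _,_; proj₁; proj₂)
open import Data.Sum using (inj₁; inj₂)
open import Data.List using (upTo; map; applyUpTo; allFin)
import Data.List as L
open import Data.List.Properties using (map-tabulate)
open import Data.List.Membership.Propositional using (find)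
open import Data.List.Membership.Propositional.Properties using (∈-upTo⁻)
open import Data.List.Relation.Unary.Any.Properties using (any⁻)
open import Data.Fin using (Fin; toℕ)
import Data.Fin.Properties as Finₚ
open import Data.Fin.Subset using (Subset; _∩_; ⊥; _∈_)
open import Data.Fin.Subset.Properties using (Empty-unique; x∈p∩q⁻)
open import Data.Fin.Permutation using (Permutation′; _⟨$⟩ʳ_; _⟨$⟩ˡ_; inverseˡ)
open import Data.Vec.Properties using ([]=⇒lookup; lookup∘tabulate)
open import Function using (_∘′_)
open import Function.Bundles using (Equivalence)
open import Relation.Nullary using (¬_; yes; no; does)
open import Relation.Unary using (Decidable)
open import Relation.Binary.Definitions using (tri<; tri≈; tri>)
open import Relation.Binary.PropositionalEquality

∑< : ℕ → (ℕ → ℕ) → ℕ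
∑< zero    f = 0
∑< (suc n) f = f 0 + ∑< n (λ k → f (suc k))

syntax ∑< n (λ k → e) = ∑[ k < n ] e

∑-cong : ∀ n {f g : ℕ → ℕ} → (∀ k → k < n → f k ≡ g k) → ∑< n f ≡ ∑< n g
∑-cong zero    eq = refl
∑-cong (suc n) eq = cong₂ _+_ (eq 0 (s≤s z≤n)) (∑-cong n (λ k k<n → eq (suc k) (s≤s k<n)))

∑-mono-≤ : ∀ n {f g : ℕ → ℕ} → (∀ k → k < n → f k ≤ g k) → ∑< n f ≤ ∑< n g
∑-mono-≤ zero    le = z≤n
∑-mono-≤ (suc n) le = +-mono-≤ (le 0 (s≤s z≤n)) (∑-mono-≤ n (λ k k<n → le (suc k) (s≤s k<n)))

∑-const : ∀ n c → ∑[ _ < n ] c ≡ n * c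
∑-const zero    c = refl
∑-const (suc n) c = cong (c +_) (∑-const n c)

∑-zero : ∀ n → ∑[ _ < n ] 0 ≡ 0
∑-zero n = trans (∑-const n 0) (*-zeroʳ n)

∑-distrib-+ : ∀ n (f g : ℕ → ℕ) → ∑[ k < n ] (f k + g k) ≡ ∑< n f + ∑< n g
∑-distrib-+ zero    f g = refl
∑-distrib-+ (suc n) f g = trans (cong (f 0 + g 0 +_) (∑-distrib-+ n _ _)) (interchange (f 0) (g 0) _ _)

*-distribˡ-∑ : ∀ n c (f : ℕ → ℕ) → c * ∑< n f ≡ ∑[ k < n ] (c * f k)
*-distribˡ-∑ zero    c f = *-zeroʳ c
*-distribˡ-∑ (suc n) c f = trans (*-distribˡ-+ c (f 0) _) (cong (c * f 0 +_) (*-distribˡ-∑ n c _))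

*-distribʳ-∑ : ∀ n c (f : ℕ → ℕ) → ∑< n f * c ≡ ∑[ k < n ] (f k * c)
*-distribʳ-∑ n c f = trans (*-comm (∑< n f) c) (trans (*-distribˡ-∑ n c f) (∑-cong n (λ k _ → *-comm c (f k))))

∑-comm : ∀ n m (f : ℕ → ℕ → ℕ) → ∑[ i < n ] ∑[ j < m ] f i j ≡ ∑[ j < m ] ∑[ i < n ] f i j
∑-comm zero    m f = sym (∑-zero m)
∑-comm (suc n) m f = trans (cong (∑[ j < m ] f 0 j +_) (∑-comm n m (λ i → f (suc i))))
                           (sym (∑-distrib-+ m (f 0) _))

∑-shift : ∀ n (f : ℕ → ℕ) → ∑[ k < n ] f (suc k) + f 0 ≡ ∑< n f + f n
∑-shift zero    f = refl
∑-shift (suc n) f = begin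
  (f 1 + ∑[ k < n ] f (2 + k)) + f 0     ≡⟨ +-comm (f 1 + _) (f 0) ⟩
  f 0 + (f 1 + ∑[ k < n ] f (2 + k))     ≡⟨ cong (f 0 +_) (+-comm (f 1) _) ⟩
  f 0 + (∑[ k < n ] f (2 + k) + f 1)     ≡⟨ cong (f 0 +_) (∑-shift n (λ k → f (suc k))) ⟩
  f 0 + (∑[ k < n ] f (suc k) + f (suc n)) ≡⟨ +-assoc (f 0) _ (f (suc n)) ⟨
  f 0 + ∑[ k < n ] f (suc k) + f (suc n)   ∎
  where open ≡-Reasoning

Periodic : ℕ → (ℕ → ℕ) → Set
Periodic n f = ∀ k → f (k + n) ≡ f k

∑-rotate : ∀ n {f} → Periodic n f → ∀ c → ∑[ k < n ] f (k + c) ≡ ∑< n f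
∑-rotate n {f} per zero    = ∑-cong n (λ k _ → cong f (+-identityʳ k))
∑-rotate n {f} per (suc c) = begin
  ∑[ k < n ] f (k + suc c)  ≡⟨ ∑-cong n (λ k _ → cong f (+-suc k c)) ⟩
  ∑[ k < n ] g (suc k)      ≡⟨ +-cancelʳ-≡ (g 0) _ _ (trans (∑-shift n g) (cong (∑< n g +_) gn≡g0)) ⟩
  ∑< n g                    ≡⟨ ∑-rotate n per c ⟩
  ∑< n f                    ∎
  where
  open ≡-Reasoning
  g : ℕ → ℕ
  g k = f (k + c)
  gn≡g0 : g n ≡ g 0
  gn≡g0 = trans (cong f (+-comm n c)) (per c)

periodic-+* : ∀ {n f} → Periodic n f → ∀ c k → f (k + c * n) ≡ f k
periodic-+* {n} {f} per zero    k = cong f (+-identityʳ k)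
periodic-+* {n} {f} per (suc c) k =
  trans (cong f (x∙yz≈xz∙y k n (c * n))) (trans (per (k + c * n)) (periodic-+* per c k))

walk-periodic : ∀ {n f} → Periodic n f → ∀ j m → Periodic n (λ k → f (j + k * m))
walk-periodic {n} {f} per j m k = trans (cong f (arith j k n m)) (periodic-+* per m (j + k * m))
  where
  arith : ∀ j k n m → j + (k + n) * m ≡ j + k * m + m * n
  arith = solve-∀

∑-walks : ∀ n m {f} → Periodic n f → ∑[ j < n ] ∑[ k < n ] f (j + k * m) ≡ n * ∑< n f
∑-walks n m {f} per = begin
  ∑[ j < n ] ∑[ k < n ] f (j + k * m)  ≡⟨ ∑-comm n n (λ j k → f (j + k * m)) ⟩
  ∑[ k < n ] ∑[ j < n ] f (j + k * m)  ≡⟨ ∑-cong n (λ k _ → ∑-rotate n per (k * m)) ⟩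
  ∑[ _ < n ] ∑< n f                    ≡⟨ ∑-const n (∑< n f) ⟩
  n * ∑< n f                           ∎
  where open ≡-Reasoning

term≤∑ : ∀ n (f : ℕ → ℕ) {i} → i < n → f i ≤ ∑< n f
term≤∑ (suc n) f {zero}  _         = m≤m+n (f 0) _
term≤∑ (suc n) f {suc i} (s≤s i<n) = ≤-trans (term≤∑ n (λ k → f (suc k)) i<n) (m≤n+m _ (f 0))

terms≤∑ : ∀ n (f : ℕ → ℕ) {i j} → i < j → j < n → f i + f j ≤ ∑< n f
terms≤∑ (suc n) f {zero}  {suc j} _         (s≤s j<n) = +-monoʳ-≤ (f 0) (term≤∑ n (λ k → f (suc k)) j<n)
terms≤∑ (suc n) f {suc i} {suc j} (s≤s i<j) (s≤s j<n) =
  ≤-trans (terms≤∑ n (λ k → f (suc k)) i<j j<n) (m≤n+m _ (f 0))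

-- Periodic walks with steps of size at most one

last-step : ∀ {P : ℕ → Set} → Decidable P → ∀ x d → P x → ¬ P (x + d) →
            ∃[ z ] x ≤ z × z < x + d × P z × ¬ P (suc z)
last-step {P} P? x zero    px ¬px = ⊥-elim (¬px (subst P (sym (+-identityʳ x)) px))
last-step {P} P? x (suc d) px ¬px with P? (x + d)
... | yes pz = x + d , m≤m+n x d , ≤-reflexive (sym (+-suc x d)) , pz , ¬px ∘′ subst P (sym (+-suc x d))
... | no ¬pz with last-step P? x d px ¬pz
...   | z , x≤z , z<x+d , p , ¬p = z , x≤z , ≤-trans z<x+d (+-monoʳ-≤ x (n≤1+n d)) , p , ¬p

StepsAtMostOne : (ℕ → ℕ) → Set
StepsAtMostOne f = ∀ k → f (suc k) ≤ suc (f k) × f k ≤ suc (f (suc k))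

up-crossing : ∀ {f} → StepsAtMostOne f → ∀ {c} x d → f x < c → c ≤ f (x + d) →
              ∃[ z ] x < z × z ≤ x + d × f z ≡ c
up-crossing {f} steps {c} x d fx<c c≤f with last-step (λ k → f k <? c) x d fx<c (≤⇒≯ c≤f)
... | z , x≤z , z<x+d , fz<c , c≤fz+1 =
  suc z , s≤s x≤z , z<x+d , ≤-antisym (≤-trans (proj₁ (steps z)) fz<c) (≮⇒≥ c≤fz+1)

down-crossing : ∀ {f} → StepsAtMostOne f → ∀ {c} x d → c < f x → f (x + d) ≤ c →
                ∃[ z ] x < z × z ≤ x + d × f z ≡ c
down-crossing {f} steps {c} x d c<fx f≤c with last-step (λ k → c <? f k) x d c<fx (≤⇒≯ f≤c)
... | z , x≤z , z<x+d , c<fz , fz+1≤c =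
  suc z , s≤s x≤z , z<x+d , ≤-antisym (≮⇒≥ fz+1≤c) (≤-pred (≤-trans c<fz (proj₂ (steps z))))

visits-twice : ∀ {f n} → Periodic n f → StepsAtMostOne f → ∀ {c a} → f 0 < c → c < f a → a < n →
               ∃[ i ] ∃[ j ] i < j × j < n × f i ≡ c × f j ≡ c
visits-twice {f} {n} per steps {c} {a} f0<c c<fa a<n
  with up-crossing steps 0 a f0<c (<⇒≤ c<fa)
     | down-crossing steps a (n ∸ a) c<fa
         (subst (λ k → f k ≤ c) (sym (m+[n∸m]≡n (<⇒≤ a<n))) (<⇒≤ (subst (_< c) (sym (per 0)) f0<c)))
... | i , _ , i≤a , fi≡c | j , a<j , j≤n , fj≡c =
  i , j , ≤-<-trans i≤a a<j , ≤∧≢⇒< (subst (j ≤_) (m+[n∸m]≡n (<⇒≤ a<n)) j≤n) j≢n , fi≡c , fj≡c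
  where
  j≢n : j ≢ n
  j≢n refl = <-irrefl fj≡c (subst (_< c) (sym (per 0)) f0<c)

-- The weight of a position

-- Spelled exactly as the summand of xcount, so that xcount unfolds to sums of δ.
-- Note that δ (suc c) (suc x) reduces to δ c x.
δ : ℕ → ℕ → ℕ
δ c x = if x ≡ᵇ c then 1 else 0

δ-refl : ∀ c → δ c c ≡ 1
δ-refl zero    = refl
δ-refl (suc c) = δ-refl c

δ-≢ : ∀ {c x} → x ≢ c → δ c x ≡ 0
δ-≢ {zero}  {zero}  x≢c = ⊥-elim (x≢c refl)
δ-≢ {suc c} {zero}  _   = refl
δ-≢ {zero}  {suc x} _   = refl
δ-≢ {suc c} {suc x} x≢c = δ-≢ (x≢c ∘′ cong suc)

∑-δ*-< : ∀ n (g : ℕ → ℕ) {y} → y < n → ∑[ i < n ] (δ i y * g i) ≡ g y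
∑-δ*-< (suc n) g {zero}  _         = trans (cong₂ _+_ (+-identityʳ (g 0)) (∑-zero n)) (+-identityʳ (g 0))
∑-δ*-< (suc n) g {suc y} (s≤s y<n) = ∑-δ*-< n (λ i → g (suc i)) y<n

∑-δ*-≥ : ∀ n (g : ℕ → ℕ) {y} → n ≤ y → ∑[ i < n ] (δ i y * g i) ≡ 0
∑-δ*-≥ zero    g _         = refl
∑-δ*-≥ (suc n) g (s≤s n≤y) = ∑-δ*-≥ n (λ i → g (suc i)) n≤y

odd : ℕ → ℕ
odd i = 2 * i + 1

-- With s = 5 + t (as throughout), weighted t x is twice x₁ + ∑_{i=1}^{s-2} (i − 3/2) x_i + x_s:
-- the summand i = 1 turns x₁ into x₁/2, and x_{2+i} gets the coefficient 2(2 + i) − 3 = odd i.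
weighted : ℕ → (ℕ → ℕ) → ℕ
weighted t x = x 1 + ∑[ i < 2 + t ] (x (2 + i) * odd i) + 2 * x (5 + t)

weight : ℕ → ℕ → ℕ
weight t v = weighted t (λ c → δ c v)

∑-weighted : ∀ t n (x : ℕ → ℕ → ℕ) →
             ∑[ j < n ] weighted t (λ c → x c j) ≡ weighted t (λ c → ∑[ j < n ] x c j)
∑-weighted t n x = begin
  ∑[ j < n ] (x 1 j + middle j + 2 * x (5 + t) j)
    ≡⟨ ∑-distrib-+ n _ _ ⟩
  ∑[ j < n ] (x 1 j + middle j) + ∑[ j < n ] (2 * x (5 + t) j)
    ≡⟨ cong₂ _+_ (∑-distrib-+ n _ _) (sym (*-distribˡ-∑ n 2 _)) ⟩
  ∑[ j < n ] x 1 j + ∑[ j < n ] middle j + 2 * ∑[ j < n ] x (5 + t) j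
    ≡⟨ cong (λ z → ∑[ j < n ] x 1 j + z + 2 * ∑[ j < n ] x (5 + t) j) swap ⟩
  weighted t (λ c → ∑[ j < n ] x c j) ∎
  where
  open ≡-Reasoning
  middle : ℕ → ℕ
  middle j = ∑[ i < 2 + t ] (x (2 + i) j * odd i)
  swap : ∑[ j < n ] middle j ≡ ∑[ i < 2 + t ] (∑[ j < n ] x (2 + i) j * odd i)
  swap = trans (∑-comm n (2 + t) (λ j i → x (2 + i) j * odd i))
               (∑-cong (2 + t) (λ i _ → sym (*-distribʳ-∑ n (odd i) (x (2 + i)))))

weighted-cong : ∀ t {x y : ℕ → ℕ} → (∀ c → x c ≡ y c) → weighted t x ≡ weighted t y
weighted-cong t eq = cong₂ _+_ (cong₂ _+_ (eq 1) (∑-cong (2 + t) (λ i _ → cong (_* odd i) (eq (2 + i)))))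
                               (cong (2 *_) (eq (5 + t)))

weight-3+t : ∀ t → weight t (3 + t) ≡ 3 + 2 * t
weight-3+t t =
  trans (cong₂ (λ a b → a + 2 * b) (∑-δ*-< (2 + t) odd ≤-refl) (δ-≢ {5 + t} (<⇒≢ (n≤1+n _))))
        (arith t)
  where
  arith : ∀ t → 2 * (1 + t) + 1 + 2 * 0 ≡ 3 + 2 * t
  arith = solve-∀

weight-4+t : ∀ t → weight t (4 + t) ≡ 0
weight-4+t t = cong₂ (λ a b → a + 2 * b) (∑-δ*-≥ (2 + t) odd ≤-refl) (δ-≢ {5 + t} (<⇒≢ ≤-refl))

weight-5+t : ∀ t → weight t (5 + t) ≡ 2
weight-5+t t = cong₂ (λ a b → a + 2 * b) (∑-δ*-≥ (2 + t) odd (n≤1+n _)) (δ-refl (5 + t))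

weight-pos : ∀ t {v} → 1 ≤ v → v ≤ 3 + t → 1 ≤ weight t v
weight-pos t {1}           _ _                 = s≤s z≤n
weight-pos t {suc (suc y)} _ (s≤s (s≤s y≤1+t)) = begin
  1                               ≤⟨ m≤n+m 1 (2 * y) ⟩
  2 * y + 1                       ≡⟨ ∑-δ*-< (2 + t) odd (s≤s y≤1+t) ⟨
  ∑[ i < 2 + t ] (δ i y * odd i)  ≤⟨ m≤m+n _ _ ⟩
  weight t (2 + y)                ∎
  where open ≤-Reasoning

period-large : ∀ t m {n} → 1 ≤ m → n + 2 ≡ (5 + t) * suc m → 6 + 2 * t ≤ n
period-large t m {n} 1≤m n+2≡ = +-cancelʳ-≤ 2 _ _ (begin
  6 + 2 * t + 2         ≤⟨ m≤m+n _ 2 ⟩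
  6 + 2 * t + 2 + 2     ≡⟨ arith t ⟩
  (5 + t) * 2           ≤⟨ *-monoʳ-≤ (5 + t) (s≤s 1≤m) ⟩
  (5 + t) * suc m       ≡⟨ n+2≡ ⟨
  n + 2                 ∎)
  where
  open ≤-Reasoning
  arith : ∀ t → 6 + 2 * t + 2 + 2 ≡ (5 + t) * 2
  arith = solve-∀

period-equation : ∀ t m {n} → n ≡ (5 + t) * m + (5 + t) ∸ 2 → n + 2 ≡ (5 + t) * suc m
period-equation t m n≡ =
  trans (cong (_+ 2) (trans n≡ (cong (_∸ 2) (+-comm ((5 + t) * m) (5 + t))))) (arith t m)
  where
  arith : ∀ t m → 3 + t + (5 + t) * m + 2 ≡ (5 + t) * suc m
  arith = solve-∀

stride-fits : ∀ t m {n} → n + 2 ≡ (5 + t) * suc m → (5 + t) * m ≤ n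
stride-fits t m {n} n+2≡ = +-cancelʳ-≤ 2 _ _ (begin
  (5 + t) * m + 2          ≤⟨ +-monoʳ-≤ ((5 + t) * m) (s≤s (s≤s z≤n)) ⟩
  (5 + t) * m + (5 + t)    ≡⟨ trans (+-comm _ (5 + t)) (sym (*-suc (5 + t) m)) ⟩
  (5 + t) * suc m          ≡⟨ n+2≡ ⟨
  n + 2                    ∎)
  where open ≤-Reasoning

weight-sum-dipping : ∀ t {n g} → Periodic n g → StepsAtMostOne g → (∀ k → 1 ≤ g k) →
                     6 + 2 * t ≤ n → g 0 < 3 + t → 6 + 2 * t ≤ ∑[ k < n ] weight t (g k)
weight-sum-dipping t {n} {g} per steps pos n-large g0<c with anyUpTo? (λ k → 3 + t <? g k) n
... | no ¬high = begin
  6 + 2 * t                  ≤⟨ n-large ⟩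
  n                          ≡⟨ trans (sym (*-identityʳ n)) (sym (∑-const n 1)) ⟩
  ∑[ _ < n ] 1               ≤⟨ ∑-mono-≤ n (λ k k<n → weight-pos t (pos k) (low k k<n)) ⟩
  ∑[ k < n ] weight t (g k)  ∎
  where
  open ≤-Reasoning
  low : ∀ k → k < n → g k ≤ 3 + t
  low k k<n = ≮⇒≥ λ c<gk → ¬high (k , k<n , c<gk)
... | yes (a , a<n , c<ga) with visits-twice per steps g0<c c<ga a<n
...   | i , j , i<j , j<n , gi≡c , gj≡c = begin
  6 + 2 * t                            ≤⟨ subst (6 + 2 * t ≤_) (arith t) (m≤m+n (6 + 2 * t) (2 * t)) ⟩
  (3 + 2 * t) + (3 + 2 * t)            ≡⟨ cong₂ _+_ (weight-at gi≡c) (weight-at gj≡c) ⟨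
  weight t (g i) + weight t (g j)      ≤⟨ terms≤∑ n (λ k → weight t (g k)) i<j j<n ⟩
  ∑[ k < n ] weight t (g k)            ∎
  where
  open ≤-Reasoning
  weight-at : ∀ {v} → v ≡ 3 + t → weight t v ≡ 3 + 2 * t
  weight-at refl = weight-3+t t
  arith : ∀ t → 6 + 2 * t + 2 * t ≡ (3 + 2 * t) + (3 + 2 * t)
  arith = solve-∀

weight-near-top : ∀ t {v} → 3 + t ≤ v → v ≤ 5 + t →
                  weight t v + 2 * (5 + t) ≡ 2 * v + 2 + (5 + 2 * t) * δ (3 + t) v
weight-near-top t {v} 3+t≤v v≤5+t with m≤n⇒m<n∨m≡n 3+t≤v
... | inj₂ refl rewrite weight-3+t t | δ-refl (3 + t) = arith t
  where
  arith : ∀ t → 3 + 2 * t + 2 * (5 + t) ≡ 2 * (3 + t) + 2 + (5 + 2 * t) * 1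
  arith = solve-∀
... | inj₁ 4+t≤v with m≤n⇒m<n∨m≡n 4+t≤v
...   | inj₂ refl rewrite weight-4+t t | δ-≢ {3 + t} (>⇒≢ (≤-refl {4 + t})) = arith t
  where
  arith : ∀ t → 2 * (5 + t) ≡ 2 * (4 + t) + 2 + (5 + 2 * t) * 0
  arith = solve-∀
...   | inj₁ 5+t≤v with ≤-antisym v≤5+t 5+t≤v
...     | refl rewrite weight-5+t t | δ-≢ {3 + t} (>⇒≢ (n≤1+n (4 + t))) = arith t
  where
  arith : ∀ t → 2 + 2 * (5 + t) ≡ 2 * (5 + t) + 2 + (5 + 2 * t) * 0
  arith = solve-∀

weight-≥-δ : ∀ t v → (3 + 2 * t) * δ (3 + t) v ≤ weight t v
weight-≥-δ t v with v ≟ 3 + t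
... | yes refl rewrite δ-refl (3 + t) | *-identityʳ (3 + 2 * t) | weight-3+t t = ≤-refl
... | no v≢3+t rewrite δ-≢ v≢3+t | *-zeroʳ (3 + 2 * t) = z≤n

m+n*d≡p*d⇒d∣m : ∀ {d m n p} → m + n * d ≡ p * d → d ∣ m
m+n*d≡p*d⇒d∣m {d} {m} {n} {p} eq = ∣m+n∣m⇒∣n (divides p (trans (+-comm (n * d) m) eq)) (n∣m*n n)

∣∧<⇒2*≤ : ∀ {d m} → d ∣ m → d < m → 2 * d ≤ m
∣∧<⇒2*≤ {d} d∣m d<m = subst (2 * d ≤_) (sym (m∣n⇒n≡quotient*m d∣m)) (*-monoˡ-≤ d (quotient>1 d∣m d<m))

weight-sum-near-top : ∀ t n {g} → (∀ k → k < n → 3 + t ≤ g k) → (∀ k → g k ≤ 5 + t) →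
  ∑[ k < n ] weight t (g k) + n * (2 * (5 + t))
    ≡ 2 * ∑< n g + n * 2 + (5 + 2 * t) * ∑[ k < n ] δ (3 + t) (g k)
weight-sum-near-top t n {g} high bounded = begin
  ∑[ k < n ] weight t (g k) + n * (2 * (5 + t))
    ≡⟨ cong (∑[ k < n ] weight t (g k) +_) (∑-const n (2 * (5 + t))) ⟨
  ∑[ k < n ] weight t (g k) + ∑[ _ < n ] (2 * (5 + t))
    ≡⟨ ∑-distrib-+ n _ _ ⟨
  ∑[ k < n ] (weight t (g k) + 2 * (5 + t))
    ≡⟨ ∑-cong n (λ k k<n → weight-near-top t (high k k<n) (bounded k)) ⟩
  ∑[ k < n ] (2 * g k + 2 + (5 + 2 * t) * δ (3 + t) (g k))
    ≡⟨ ∑-distrib-+ n _ _ ⟩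
  ∑[ k < n ] (2 * g k + 2) + ∑[ k < n ] ((5 + 2 * t) * δ (3 + t) (g k))
    ≡⟨ cong₂ _+_ (∑-distrib-+ n _ _) (sym (*-distribˡ-∑ n (5 + 2 * t) _)) ⟩
  ∑[ k < n ] (2 * g k) + ∑[ _ < n ] 2 + (5 + 2 * t) * ∑[ k < n ] δ (3 + t) (g k)
    ≡⟨ cong₂ (λ a b → a + b + (5 + 2 * t) * ∑[ k < n ] δ (3 + t) (g k))
             (sym (*-distribˡ-∑ n 2 g)) (∑-const n 2) ⟩
  2 * ∑< n g + n * 2 + (5 + 2 * t) * ∑[ k < n ] δ (3 + t) (g k) ∎
  where open ≡-Reasoning

near-top-divisibility : ∀ t m {n A} G h X → n + 2 ≡ (5 + t) * suc m → G ≡ (5 + t) * A →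
                        X + n * (2 * (5 + t)) ≡ 2 * G + n * 2 + (5 + 2 * t) * h →
                        2 * (5 + t) ∣ 4 + 5 * h + X
near-top-divisibility t m {n} {A} G h X n+2≡ G≡ sum≡ =
  m+n*d≡p*d⇒d∣m {n = n} {p = A + suc m + h} (begin
    (4 + 5 * h + X) + n * (2 * (5 + t))
      ≡⟨ arith₁ X (n * (2 * (5 + t))) (4 + 5 * h) ⟩
    (X + n * (2 * (5 + t))) + (4 + 5 * h)
      ≡⟨ cong (_+ (4 + 5 * h)) sum≡ ⟩
    2 * G + n * 2 + (5 + 2 * t) * h + (4 + 5 * h)
      ≡⟨ arith₂ t G n h ⟩
    2 * G + (n + 2) * 2 + 2 * (5 + t) * h
      ≡⟨ cong₂ (λ a b → 2 * a + b * 2 + 2 * (5 + t) * h) G≡ n+2≡ ⟩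
    2 * ((5 + t) * A) + (5 + t) * suc m * 2 + 2 * (5 + t) * h
      ≡⟨ arith₃ t A m h ⟩
    (A + suc m + h) * (2 * (5 + t)) ∎)
  where
  open ≡-Reasoning
  arith₁ : ∀ x y z → z + x + y ≡ x + y + z
  arith₁ = solve-∀
  arith₂ : ∀ t G n h → 2 * G + n * 2 + (5 + 2 * t) * h + (4 + 5 * h)
                     ≡ 2 * G + (n + 2) * 2 + 2 * (5 + t) * h
  arith₂ = solve-∀
  arith₃ : ∀ t A m h → 2 * ((5 + t) * A) + (5 + t) * suc m * 2 + 2 * (5 + t) * h
                     ≡ (A + suc m + h) * (2 * (5 + t))
  arith₃ = solve-∀

bound-from-visits : ∀ t h X → 2 * (5 + t) ∣ 4 + 5 * h + X → (3 + 2 * t) * h ≤ X → 6 + 2 * t ≤ X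
bound-from-visits t 0 X d∣ _ = +-cancelˡ-≤ 4 _ _ (subst (_≤ 4 + X) (arith t) (∣⇒≤ d∣))
  where
  arith : ∀ t → 2 * (5 + t) ≡ 4 + (6 + 2 * t)
  arith = solve-∀
bound-from-visits t 1 X d∣ lb = ≤-trans (m≤m+n (6 + 2 * t) (5 + 2 * t))
                                        (+-cancelˡ-≤ 9 _ _ (subst (_≤ 9 + X) (arith₁ t) (∣∧<⇒2*≤ d∣ d<9+X)))
  where
  arith₁ : ∀ t → 2 * (2 * (5 + t)) ≡ 9 + (6 + 2 * t + (5 + 2 * t))
  arith₁ = solve-∀
  arith₂ : ∀ t → 9 + (3 + 2 * t) ≡ 1 + suc (2 * (5 + t))
  arith₂ = solve-∀
  d<9+X : 2 * (5 + t) < 9 + X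
  d<9+X = ≤-trans (subst (suc (2 * (5 + t)) ≤_) (sym (arith₂ t)) (m≤n+m _ 1))
                  (+-monoʳ-≤ 9 (subst (_≤ X) (*-identityʳ (3 + 2 * t)) lb))
bound-from-visits t (suc (suc h)) X _ lb = ≤-trans (subst (6 + 2 * t ≤_) (arith t) (m≤m+n _ (2 * t)))
                                                  (≤-trans (*-monoʳ-≤ (3 + 2 * t) (m≤m+n 2 h)) lb)
  where
  arith : ∀ t → 6 + 2 * t + 2 * t ≡ (3 + 2 * t) * 2
  arith = solve-∀

weight-sum-high : ∀ t m {n g A} → n + 2 ≡ (5 + t) * suc m → (∀ k → k < n → 3 + t ≤ g k) →
                  (∀ k → g k ≤ 5 + t) → ∑< n g ≡ (5 + t) * A → 6 + 2 * t ≤ ∑[ k < n ] weight t (g k)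
weight-sum-high t m {n} {g} {A} n+2≡ high bounded ∑g≡ =
  bound-from-visits t h X
    (near-top-divisibility t m {n} {A} (∑< n g) h X n+2≡ ∑g≡ (weight-sum-near-top t n high bounded))
    (≤-trans (≤-reflexive (*-distribˡ-∑ n (3 + 2 * t) _)) (∑-mono-≤ n (λ k _ → weight-≥-δ t (g k))))
  where
  X = ∑[ k < n ] weight t (g k)
  h = ∑[ k < n ] δ (3 + t) (g k)

weight-sum-walk : ∀ t m {n g A} → 1 ≤ m → n + 2 ≡ (5 + t) * suc m → Periodic n g → StepsAtMostOne g →
                  (∀ k → 1 ≤ g k) → (∀ k → g k ≤ 5 + t) → ∑< n g ≡ (5 + t) * A →
                  6 + 2 * t ≤ ∑[ k < n ] weight t (g k)
weight-sum-walk t m {n} {g} {A} 1≤m n+2≡ per steps pos bounded ∑g≡ with anyUpTo? (λ k → g k <? 3 + t) n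
... | no ¬low = weight-sum-high t m {A = A} n+2≡ (λ k k<n → ≮⇒≥ λ gk<c → ¬low (k , k<n , gk<c))
                                bounded ∑g≡
... | yes (b , _ , gb<c) =
  subst (6 + 2 * t ≤_) (∑-rotate n {λ k → weight t (g k)} (λ k → cong (weight t) (per k)) b)
        (weight-sum-dipping t rotated-periodic (λ k → steps (k + b)) (λ k → pos (k + b))
                            (period-large t m 1≤m n+2≡) gb<c)
  where
  rotated-periodic : Periodic n (λ k → g (k + b))
  rotated-periodic k = trans (cong g (xy∙z≈xz∙y k n b)) (per (k + b))

-- Arithmetic progressions in a periodic 0/1 sequence

strideSum : (ℕ → ℕ) → ℕ → ℕ → ℕ → ℕ
strideSum a s m i = ∑[ u < s ] a (i + u * m)

strideSum-periodic : ∀ {n a} → Periodic n a → ∀ s m → Periodic n (strideSum a s m)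
strideSum-periodic {n} {a} per s m i =
  ∑-cong s (λ u _ → trans (cong a (xy∙z≈xz∙y i n (u * m))) (per (i + u * m)))

strideSum-≤ : ∀ {a} → (∀ i → a i ≤ 1) → ∀ s m i → strideSum a s m i ≤ s
strideSum-≤ {a} a≤1 s m i = begin
  strideSum a s m i  ≤⟨ ∑-mono-≤ s (λ u _ → a≤1 (i + u * m)) ⟩
  ∑[ _ < s ] 1       ≡⟨ trans (∑-const s 1) (*-identityʳ s) ⟩
  s                  ∎
  where open ≤-Reasoning

strideSum-step : ∀ a s m i → strideSum a s m (i + m) + a i ≡ strideSum a s m i + a (i + s * m)
strideSum-step a s m i = begin
  strideSum a s m (i + m) + a i  ≡⟨ cong₂ _+_ (∑-cong s (λ u _ → cong a (+-assoc i m (u * m))))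
                                              (cong a (sym (+-identityʳ i))) ⟩
  ∑[ u < s ] b (suc u) + b 0     ≡⟨ ∑-shift s b ⟩
  strideSum a s m i + a (i + s * m) ∎
  where
  open ≡-Reasoning
  b : ℕ → ℕ
  b u = a (i + u * m)

strideSum-walk-steps : ∀ {a} → (∀ i → a i ≤ 1) → ∀ s m j → StepsAtMostOne (λ k → strideSum a s m (j + k * m))
strideSum-walk-steps {a} a≤1 s m j k =
  subst (λ y → M y ≤ suc (M x)) x+m≡ up , subst (λ y → M x ≤ suc (M y)) x+m≡ down
  where
  M : ℕ → ℕ
  M = strideSum a s m
  x = j + k * m
  x+m≡ : x + m ≡ j + suc k * m
  x+m≡ = xy∙z≈x∙zy j (k * m) m
  up : M (x + m) ≤ suc (M x)
  up = begin
    M (x + m)              ≤⟨ m≤m+n _ (a x) ⟩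
    M (x + m) + a x        ≡⟨ strideSum-step a s m x ⟩
    M x + a (x + s * m)    ≤⟨ +-monoʳ-≤ (M x) (a≤1 _) ⟩
    M x + 1                ≡⟨ +-comm (M x) 1 ⟩
    suc (M x)              ∎
    where open ≤-Reasoning
  down : M x ≤ suc (M (x + m))
  down = begin
    M x                    ≤⟨ m≤m+n _ _ ⟩
    M x + a (x + s * m)    ≡⟨ strideSum-step a s m x ⟨
    M (x + m) + a x        ≤⟨ +-monoʳ-≤ (M (x + m)) (a≤1 x) ⟩
    M (x + m) + 1          ≡⟨ +-comm (M (x + m)) 1 ⟩
    suc (M (x + m))        ∎
    where open ≤-Reasoning

∑-strideSum-walk : ∀ {n a} → Periodic n a → ∀ s m j →
                   ∑[ k < n ] strideSum a s m (j + k * m) ≡ s * ∑[ k < n ] a (j + k * m)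
∑-strideSum-walk {n} {a} per s m j = begin
  ∑[ k < n ] ∑[ u < s ] a (j + k * m + u * m)  ≡⟨ ∑-comm n s (λ k u → a (j + k * m + u * m)) ⟩
  ∑[ u < s ] ∑[ k < n ] a (j + k * m + u * m)  ≡⟨ ∑-cong s (λ u _ → ∑-cong n (λ k _ → cong a (arith j k u m))) ⟩
  ∑[ u < s ] ∑[ k < n ] b (k + u)              ≡⟨ ∑-cong s (λ u _ → ∑-rotate n (walk-periodic per j m) u) ⟩
  ∑[ _ < s ] ∑< n b                            ≡⟨ ∑-const s (∑< n b) ⟩
  s * ∑< n b                                   ∎
  where
  open ≡-Reasoning
  b : ℕ → ℕ
  b k = a (j + k * m)
  arith : ∀ j k u m → j + k * m + u * m ≡ j + (k + u) * m
  arith = solve-∀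

weight-sum-strideSum : ∀ t m {n a} → 1 ≤ m → n + 2 ≡ (5 + t) * suc m → Periodic n a → (∀ i → a i ≤ 1) →
                       (∀ i → 1 ≤ strideSum a (5 + t) m i) →
                       6 + 2 * t ≤ ∑[ i < n ] weight t (strideSum a (5 + t) m i)
weight-sum-strideSum t m {n} {a} 1≤m n+2≡ per a≤1 pos =
  *-cancelˡ-≤ n {{>-nonZero (≤-trans (s≤s z≤n) (period-large t m 1≤m n+2≡))}} (begin
    n * (6 + 2 * t)                       ≡⟨ ∑-const n _ ⟨
    ∑[ _ < n ] (6 + 2 * t)                ≤⟨ ∑-mono-≤ n (λ j _ → walk-bound j) ⟩
    ∑[ j < n ] ∑[ k < n ] W (j + k * m)   ≡⟨ ∑-walks n m (λ i → cong (weight t) (M-periodic i)) ⟩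
    n * ∑< n W                            ∎)
  where
  open ≤-Reasoning
  M : ℕ → ℕ
  M = strideSum a (5 + t) m
  W : ℕ → ℕ
  W i = weight t (M i)
  M-periodic : Periodic n M
  M-periodic = strideSum-periodic per (5 + t) m
  walk-bound : ∀ j → 6 + 2 * t ≤ ∑[ k < n ] W (j + k * m)
  walk-bound j =
    weight-sum-walk t m {A = ∑[ k < n ] a (j + k * m)} 1≤m n+2≡
      (walk-periodic M-periodic j m) (strideSum-walk-steps a≤1 (5 + t) m j)
      (λ k → pos (j + k * m)) (λ k → strideSum-≤ a≤1 (5 + t) m (j + k * m))
      (∑-strideSum-walk per (5 + t) m j)

∈-D⁻ : ∀ {n} (σ : Permutation′ n) m j {z} → z ∈ D σ m j → ∃[ k ] k < m × σ ⟨$⟩ʳ shift j k ≡ z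
-- The second with-argument rules out the case false (it would give inside ≡ outside).
∈-D⁻ σ m j {z} z∈D
  with any (λ k → does ((σ ⟨$⟩ʳ shift j k) Finₚ.≟ z)) (upTo m) in hit
     | trans (sym ([]=⇒lookup z∈D)) (lookup∘tabulate _ z)
... | true | _ with find (any⁻ _ (upTo m) (Equivalence.from T-≡ hit))
...   | k , k∈upTo , hitₖ with (σ ⟨$⟩ʳ shift j k) Finₚ.≟ z
...     | yes σk≡z = k , ∈-upTo⁻ k∈upTo , σk≡z

D-disjoint : ∀ {n} (σ : Permutation′ n) m i j → (∀ {k k′} → k < m → k′ < m → shift i k ≢ shift j k′) →
             D σ m i ∩ D σ m j ≡ ⊥
D-disjoint σ m i j no-collision = Empty-unique λ (z , z∈D∩D) →
  let z∈Di , z∈Dj  = x∈p∩q⁻ (D σ m i) (D σ m j) z∈D∩D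
      k  , k<m  , σk≡z  = ∈-D⁻ σ m i z∈Di
      k′ , k′<m , σk′≡z = ∈-D⁻ σ m j z∈Dj
  in no-collision k<m k′<m (begin
       shift i k                        ≡⟨ inverseˡ σ ⟨
       σ ⟨$⟩ˡ (σ ⟨$⟩ʳ shift i k)        ≡⟨ cong (σ ⟨$⟩ˡ_) (trans σk≡z (sym σk′≡z)) ⟩
       σ ⟨$⟩ˡ (σ ⟨$⟩ʳ shift j k′)       ≡⟨ inverseˡ σ ⟩
       shift j k′                       ∎)
  where open ≡-Reasoning

toℕ-mod : ∀ {N} .{{_ : NonZero N}} x → toℕ (x mod N) ≡ x % N
toℕ-mod {N} x = Finₚ.toℕ-fromℕ< (m%n<n x N)

toℕ-shift-mod : ∀ {n} x k → toℕ (shift (x mod suc n) k) ≡ (x + k) % suc n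
toℕ-shift-mod {n} x k = begin
  toℕ (shift (x mod N) k)          ≡⟨ toℕ-mod (toℕ (x mod N) + k) ⟩
  (toℕ (x mod N) + k) % N          ≡⟨ cong (λ r → (r + k) % N) (toℕ-mod x) ⟩
  (x % N + k) % N                  ≡⟨ %-distribˡ-+ (x % N) k N ⟩
  (x % N % N + k % N) % N          ≡⟨ cong (λ r → (r + k % N) % N) (m%n%n≡m%n x N) ⟩
  (x % N + k % N) % N              ≡⟨ %-distribˡ-+ x k N ⟨
  (x + k) % N                      ∎
  where
  open ≡-Reasoning
  N = suc n

%-injective-window : ∀ {N} .{{_ : NonZero N}} {x y} → x < y → y < x + N → x % N ≢ y % N
%-injective-window {N} {x} {y} x<y y<x+N eq = <-irrefl refl (<-≤-trans y<x+N x+N≤y)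
  where
  qx = x ℕ./ N
  qy = y ℕ./ N
  x≡ : x ≡ x % N + qx * N
  x≡ = m≡m%n+[m/n]*n x N
  y≡ : y ≡ x % N + qy * N
  y≡ = trans (m≡m%n+[m/n]*n y N) (cong (_+ qy * N) (sym eq))
  qx<qy : qx < qy
  qx<qy = *-cancelʳ-< N qx qy (+-cancelˡ-< (x % N) _ _ (subst₂ _<_ x≡ y≡ x<y))
  x+N≤y : x + N ≤ y
  x+N≤y = begin
    x + N                 ≡⟨ cong (_+ N) x≡ ⟩
    x % N + qx * N + N    ≡⟨ xy∙z≈x∙zy (x % N) (qx * N) N ⟩
    x % N + suc qx * N    ≤⟨ +-monoʳ-≤ (x % N) (*-monoˡ-≤ N qx<qy) ⟩
    x % N + qy * N        ≡⟨ y≡ ⟨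
    y                     ∎
    where open ≤-Reasoning

stride-gap : ∀ {s m N} i {u u′ k k′} → s * m ≤ N → u < u′ → u′ < s → k < m → k′ < m →
             i + u * m + k < i + u′ * m + k′ × i + u′ * m + k′ < i + u * m + k + N
stride-gap {s} {m} {N} i {u} {u′} {k} {k′} sm≤N u<u′ u′<s k<m k′<m = x<y , y<x+N
  where
  open ≤-Reasoning
  x<y : i + u * m + k < i + u′ * m + k′
  x<y = begin-strict
    i + u * m + k     <⟨ +-monoʳ-< (i + u * m) k<m ⟩
    i + u * m + m     ≡⟨ xy∙z≈x∙zy i (u * m) m ⟩
    i + suc u * m     ≤⟨ +-monoʳ-≤ i (*-monoˡ-≤ m u<u′) ⟩
    i + u′ * m        ≤⟨ m≤m+n _ k′ ⟩
    i + u′ * m + k′   ∎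
  y<x+N : i + u′ * m + k′ < i + u * m + k + N
  y<x+N = begin-strict
    i + u′ * m + k′   <⟨ +-monoʳ-< (i + u′ * m) k′<m ⟩
    i + u′ * m + m    ≡⟨ xy∙z≈x∙zy i (u′ * m) m ⟩
    i + suc u′ * m    ≤⟨ +-monoʳ-≤ i (*-monoˡ-≤ m u′<s) ⟩
    i + s * m         ≤⟨ +-monoʳ-≤ i sm≤N ⟩
    i + N             ≤⟨ +-monoˡ-≤ N (≤-trans (m≤m+n i (u * m)) (m≤m+n _ k)) ⟩
    i + u * m + k + N ∎

strided-blocks-disjoint : ∀ {n} (σ : Permutation′ (suc n)) s m i {u u′} → s * m ≤ suc n →
                          u < s → u′ < s → u ≢ u′ →
                          D σ m ((i + u * m) mod suc n) ∩ D σ m ((i + u′ * m) mod suc n) ≡ ⊥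
strided-blocks-disjoint {n} σ s m i {u} {u′} sm≤N u<s u′<s u≢u′ =
  D-disjoint σ m ((i + u * m) mod suc n) ((i + u′ * m) mod suc n) no-collision
  where
  distinct-residues : ∀ {v v′ k k′} → v < v′ → v′ < s → k < m → k′ < m →
                      (i + v * m + k) % suc n ≢ (i + v′ * m + k′) % suc n
  distinct-residues v<v′ v′<s k<m k′<m with stride-gap i sm≤N v<v′ v′<s k<m k′<m
  ... | x<y , y<x+N = %-injective-window x<y y<x+N
  no-collision : ∀ {k k′} → k < m → k′ < m →
                 shift ((i + u * m) mod suc n) k ≢ shift ((i + u′ * m) mod suc n) k′
  no-collision {k} {k′} k<m k′<m eq =
    by-order (trans (sym (toℕ-shift-mod (i + u * m) k))
                    (trans (cong toℕ eq) (toℕ-shift-mod (i + u′ * m) k′)))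
    where
    by-order : ¬ (i + u * m + k) % suc n ≡ (i + u′ * m + k′) % suc n
    by-order with <-cmp u u′
    ... | tri< u<u′ _ _ = distinct-residues u<u′ u′<s k<m k′<m
    ... | tri≈ _ u≡u′ _ = λ _ → u≢u′ u≡u′
    ... | tri> _ _ u′<u = distinct-residues u′<u u<s k′<m k<m ∘′ sym

sum-applyUpTo : ∀ n (f g : ℕ → ℕ) → sum (map f (applyUpTo g n)) ≡ ∑[ k < n ] f (g k)
sum-applyUpTo zero    f g = refl
sum-applyUpTo (suc n) f g = cong (f (g 0) +_) (sum-applyUpTo n f (λ k → g (suc k)))

sum-allFin : ∀ n (G : ℕ → ℕ) → sum (map (λ j → G (toℕ j)) (allFin n)) ≡ ∑< n G
sum-allFin n G = trans (cong sum (map-tabulate {n = n} (λ j → j) (λ j → G (toℕ j)))) (sum-tabulate n G)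
  where
  sum-tabulate : ∀ n (G : ℕ → ℕ) → sum (L.tabulate {n = n} (λ j → G (toℕ j))) ≡ ∑< n G
  sum-tabulate zero    G = refl
  sum-tabulate (suc n) G = cong (G 0 +_) (sum-tabulate n (λ k → G (suc k)))

module _ {n : ℕ} (𝓕 : Family (suc n)) (σ : Permutation′ (suc n)) (m : ℕ) where

  private
    N = suc n

  -- missing i = 1 iff D_i ∉ 𝓕 (indices mod n), so strideSum missing s m j is missCount 𝓕 σ s m j.
  missing : ℕ → ℕ
  missing i = if 𝓕 (D σ m (i mod N)) then 0 else 1

  missing-≤1 : ∀ i → missing i ≤ 1
  missing-≤1 i with 𝓕 (D σ m (i mod N))
  ... | true  = z≤n
  ... | false = ≤-refl

  missing≡0⇒∈ : ∀ i → missing i ≡ 0 → 𝓕 (D σ m (i mod N)) ≡ true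
  missing≡0⇒∈ i with 𝓕 (D σ m (i mod N))
  ... | true = λ _ → refl

  missing-periodic : Periodic N missing
  missing-periodic i = cong (λ j → if 𝓕 (D σ m j) then 0 else 1)
    (Finₚ.toℕ-injective (trans (toℕ-mod (i + N)) (trans ([m+n]%n≡m%n i N) (sym (toℕ-mod i)))))

  xcount≡∑δ : ∀ s c → xcount 𝓕 σ s m c ≡ ∑[ j < N ] δ c (strideSum missing s m j)
  xcount≡∑δ s c = trans (sum-allFin N (λ j → δ c (sum (map (λ u → missing (j + u * m)) (upTo s)))))
                        (∑-cong N (λ j _ → cong (δ c) (sum-applyUpTo s (λ u → missing (j + u * m)) (λ u → u))))

  strideSum-missing-pos : ∀ s → νLessThan 𝓕 s → s * m ≤ N → ∀ i → 1 ≤ strideSum missing s m i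
  strideSum-missing-pos s ν sm≤N i = n≢0⇒n>0 λ none-missing → ν (blocks , members none-missing , disjoint)
    where
    blocks : Fin s → Subset N
    blocks u = D σ m ((i + toℕ u * m) mod N)
    members : strideSum missing s m i ≡ 0 → ∀ u → 𝓕 (blocks u) ≡ true
    members none-missing u = missing≡0⇒∈ (i + toℕ u * m) (n≤0⇒n≡0
      (subst (missing (i + toℕ u * m) ≤_) none-missing (term≤∑ s (λ u → missing (i + u * m)) (Finₚ.toℕ<n u))))
    disjoint : ∀ u u′ → u ≢ u′ → blocks u ∩ blocks u′ ≡ ⊥
    disjoint u u′ u≢u′ =
      strided-blocks-disjoint σ s m i sm≤N (Finₚ.toℕ<n u) (Finₚ.toℕ<n u′) (u≢u′ ∘′ Finₚ.toℕ-injective)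

weighted-xcount-bound : ∀ t m {n} → 1 ≤ m → suc n + 2 ≡ (5 + t) * suc m → (𝓕 : Family (suc n)) →
                        νLessThan 𝓕 (5 + t) → (σ : Permutation′ (suc n)) →
                        6 + 2 * t ≤ weighted t (xcount 𝓕 σ (5 + t) m)
weighted-xcount-bound t m {n} 1≤m n+2≡ 𝓕 ν σ = begin
  6 + 2 * t
    ≤⟨ weight-sum-strideSum t m 1≤m n+2≡ (missing-periodic 𝓕 σ m) (missing-≤1 𝓕 σ m)
                            (strideSum-missing-pos 𝓕 σ m (5 + t) ν (stride-fits t m n+2≡)) ⟩
  ∑[ j < suc n ] weight t (M j)
    ≡⟨ ∑-weighted t (suc n) (λ c j → δ c (M j)) ⟩
  weighted t (λ c → ∑[ j < suc n ] δ c (M j))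
    ≡⟨ weighted-cong t (xcount≡∑δ 𝓕 σ m (5 + t)) ⟨
  weighted t (xcount 𝓕 σ (5 + t) m) ∎
  where
  open ≤-Reasoning
  M : ℕ → ℕ
  M = strideSum (missing 𝓕 σ m) (5 + t) m

-- Passing to ℚ

-- Imported only here: with the prefix +_ of ℤ in scope, ℕ sections such as (c +_) no longer parse.
open import Data.Integer using (+_)
import Data.Integer as ℤ
import Data.Integer.Properties as ℤ
import Data.Nat.Coprimality as C
open import Data.List using (foldr)
open import Data.Rational using (ℚ; 0ℚ; _/_; ½; toℚᵘ)
  renaming (_+_ to _+ℚ_; _*_ to _*ℚ_; _-_ to _-ℚ_; _≤_ to _≤ℚ_)
import Data.Rational.Properties as ℚ
open import Data.Rational.Unnormalised using (mkℚᵘ) renaming (_+_ to _+ᵘ_; _*_ to _*ᵘ_)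
import Data.Rational.Unnormalised as ℚᵘ
import Data.Rational.Unnormalised.Properties as ℚᵘ
open import Data.Rational.Solver using (module +-*-Solver)

fromℕ : ℕ → ℚ
fromℕ k = + k / 1

toℚᵘ-fromℕ : ∀ k → toℚᵘ (fromℕ k) ≡ mkℚᵘ (+ k) 0
toℚᵘ-fromℕ k = cong toℚᵘ (ℚ.normalize-coprime (C.sym (C.1-coprimeTo k)))

fromℕ-+ : ∀ a b → fromℕ (a + b) ≡ fromℕ a +ℚ fromℕ b
fromℕ-+ a b = ℚ.toℚᵘ-injective (begin
  toℚᵘ (fromℕ (a + b))                 ≡⟨ toℚᵘ-fromℕ (a + b) ⟩
  mkℚᵘ (+ (a + b)) 0                   ≈⟨ ℚᵘ.*≡* (cong (ℤ._* + 1) (trans (ℤ.pos-+ a b)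
                                            (sym (cong₂ ℤ._+_ (ℤ.*-identityʳ (+ a)) (ℤ.*-identityʳ (+ b)))))) ⟩
  mkℚᵘ (+ a) 0 +ᵘ mkℚᵘ (+ b) 0         ≡⟨ cong₂ _+ᵘ_ (toℚᵘ-fromℕ a) (toℚᵘ-fromℕ b) ⟨
  toℚᵘ (fromℕ a) +ᵘ toℚᵘ (fromℕ b)     ≈⟨ ℚ.toℚᵘ-homo-+ (fromℕ a) (fromℕ b) ⟨
  toℚᵘ (fromℕ a +ℚ fromℕ b)            ∎)
  where open ℚᵘ.≃-Reasoning

fromℕ-* : ∀ a b → fromℕ (a * b) ≡ fromℕ a *ℚ fromℕ b
fromℕ-* a b = ℚ.toℚᵘ-injective (begin
  toℚᵘ (fromℕ (a * b))                 ≡⟨ toℚᵘ-fromℕ (a * b) ⟩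
  mkℚᵘ (+ (a * b)) 0                   ≈⟨ ℚᵘ.*≡* (cong (ℤ._* + 1) (ℤ.pos-* a b)) ⟩
  mkℚᵘ (+ a) 0 *ᵘ mkℚᵘ (+ b) 0         ≡⟨ cong₂ _*ᵘ_ (toℚᵘ-fromℕ a) (toℚᵘ-fromℕ b) ⟨
  toℚᵘ (fromℕ a) *ᵘ toℚᵘ (fromℕ b)     ≈⟨ ℚ.toℚᵘ-homo-* (fromℕ a) (fromℕ b) ⟨
  toℚᵘ (fromℕ a *ℚ fromℕ b)            ∎)
  where open ℚᵘ.≃-Reasoning

fromℕ-mono-≤ : ∀ {a b} → a ≤ b → fromℕ a ≤ℚ fromℕ b
fromℕ-mono-≤ {a} {b} a≤b = ℚ.toℚᵘ-cancel-≤ (subst₂ ℚᵘ._≤_ (sym (toℚᵘ-fromℕ a)) (sym (toℚᵘ-fromℕ b))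
  (ℚᵘ.*≤* (subst₂ ℤ._≤_ (sym (ℤ.*-identityʳ (+ a))) (sym (ℤ.*-identityʳ (+ b))) (ℤ.+≤+ a≤b))))

foldr-applyUpTo-½ : ∀ n (F : ℕ → ℚ) (g H : ℕ → ℕ) → (∀ k → F (g k) ≡ fromℕ (H k) *ℚ ½) →
                    foldr _+ℚ_ 0ℚ (map F (applyUpTo g n)) ≡ fromℕ (∑< n H) *ℚ ½
foldr-applyUpTo-½ zero    F g H eq = refl
foldr-applyUpTo-½ (suc n) F g H eq = begin
  F (g 0) +ℚ foldr _+ℚ_ 0ℚ (map F (applyUpTo (λ k → g (suc k)) n))
    ≡⟨ cong₂ _+ℚ_ (eq 0) (foldr-applyUpTo-½ n F (λ k → g (suc k)) (λ k → H (suc k)) (λ k → eq (suc k))) ⟩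
  fromℕ (H 0) *ℚ ½ +ℚ fromℕ (∑[ k < n ] H (suc k)) *ℚ ½
    ≡⟨ ℚ.*-distribʳ-+ ½ (fromℕ (H 0)) _ ⟨
  (fromℕ (H 0) +ℚ fromℕ (∑[ k < n ] H (suc k))) *ℚ ½
    ≡⟨ cong (_*ℚ ½) (fromℕ-+ (H 0) _) ⟨
  fromℕ (∑< (suc n) H) *ℚ ½ ∎
  where open ≡-Reasoning

odd-coefficient : ∀ i y → (fromℕ (2 + i) -ℚ + 3 / 2) *ℚ fromℕ y ≡ fromℕ (y * odd i) *ℚ ½
odd-coefficient i y = begin
  (fromℕ (2 + i) -ℚ + 3 / 2) *ℚ fromℕ y
    ≡⟨ cong (λ z → (z -ℚ + 3 / 2) *ℚ fromℕ y) (fromℕ-+ 2 i) ⟩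
  ((fromℕ 2 +ℚ fromℕ i) -ℚ + 3 / 2) *ℚ fromℕ y
    ≡⟨ solve 2 (λ I Y → ((con (fromℕ 2) :+ I) :- con (+ 3 / 2)) :* Y
                        := (Y :* (con (fromℕ 2) :* I :+ con (fromℕ 1))) :* con ½) refl (fromℕ i) (fromℕ y) ⟩
  (fromℕ y *ℚ (fromℕ 2 *ℚ fromℕ i +ℚ fromℕ 1)) *ℚ ½
    ≡⟨ cong (λ z → (fromℕ y *ℚ z) *ℚ ½) (trans (fromℕ-+ (2 * i) 1) (cong (_+ℚ fromℕ 1) (fromℕ-* 2 i))) ⟨
  (fromℕ y *ℚ fromℕ (odd i)) *ℚ ½
    ≡⟨ cong (_*ℚ ½) (fromℕ-* y (odd i)) ⟨
  fromℕ (y * odd i) *ℚ ½ ∎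
  where
  open ≡-Reasoning
  open +-*-Solver

weighted-as-ℚ : ∀ t (X : ℕ → ℕ) →
  let x : ℕ → ℚ
      x i = fromℕ (X i)
  in x 1 +ℚ foldr _+ℚ_ 0ℚ (map (λ i → (fromℕ i -ℚ + 3 / 2) *ℚ x i) (applyUpTo suc (3 + t))) +ℚ x (5 + t)
     ≡ fromℕ (weighted t X) *ℚ ½
weighted-as-ℚ t X = begin
  x₁ +ℚ ((fromℕ 1 -ℚ + 3 / 2) *ℚ x₁ +ℚ foldr _+ℚ_ 0ℚ (map F (applyUpTo (λ k → 2 + k) (2 + t)))) +ℚ xₛ
    ≡⟨ cong (λ z → x₁ +ℚ ((fromℕ 1 -ℚ + 3 / 2) *ℚ x₁ +ℚ z) +ℚ xₛ)
            (foldr-applyUpTo-½ (2 + t) F (λ k → 2 + k) (λ i → X (2 + i) * odd i)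
                               (λ i → odd-coefficient i (X (2 + i)))) ⟩
  x₁ +ℚ ((fromℕ 1 -ℚ + 3 / 2) *ℚ x₁ +ℚ fromℕ T *ℚ ½) +ℚ xₛ
    ≡⟨ solve 3 (λ A B C → A :+ ((con (fromℕ 1) :- con (+ 3 / 2)) :* A :+ B :* con ½) :+ C
                        := (A :+ B :+ con (fromℕ 2) :* C) :* con ½) refl x₁ (fromℕ T) xₛ ⟩
  (x₁ +ℚ fromℕ T +ℚ fromℕ 2 *ℚ xₛ) *ℚ ½
    ≡⟨ cong (_*ℚ ½) (trans (fromℕ-+ (X 1 + T) (2 * X (5 + t)))
                           (cong₂ _+ℚ_ (fromℕ-+ (X 1) T) (fromℕ-* 2 (X (5 + t))))) ⟨
  fromℕ (weighted t X) *ℚ ½ ∎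
  where
  open ≡-Reasoning
  x₁ = fromℕ (X 1)
  xₛ = fromℕ (X (5 + t))
  F : ℕ → ℚ
  F i = (fromℕ i -ℚ + 3 / 2) *ℚ fromℕ (X i)
  T = ∑[ i < 2 + t ] (X (2 + i) * odd i)
  open +-*-Solver

½-bound : ∀ k {v} → 2 * k ≤ v → fromℕ k ≤ℚ fromℕ v *ℚ ½
½-bound k 2k≤v = ℚ.≤-trans (ℚ.≤-reflexive k≡2k*½) (ℚ.*-monoʳ-≤-nonNeg ½ (fromℕ-mono-≤ 2k≤v))
  where
  k≡2k*½ : fromℕ k ≡ fromℕ (2 * k) *ℚ ½
  k≡2k*½ = trans (solve 1 (λ K → K := (con (fromℕ 2) :* K) :* con ½) refl (fromℕ k))
                 (cong (_*ℚ ½) (sym (fromℕ-* 2 k)))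
    where open +-*-Solver

lemma6 : (s m n : ℕ) → 5 ≤ s → 1 ≤ m → n ≡ s * m + s ∸ 2 →
    (𝓕 : Family n) → νLessThan 𝓕 s → (σ : Permutation′ n) →
    let x : ℕ → ℚ
        x i = + xcount 𝓕 σ s m i / 1
    in ((+ (s ∸ 2)) / 1)
       ≤ℚ (x 1 +ℚ foldr _+ℚ_ 0ℚ
                  (map (λ i → ((+ i / 1) -ℚ (+ 3 / 2)) *ℚ x i)
                       (applyUpTo suc (s ∸ 2)))
               +ℚ x s)
lemma6 .(5 + t) m zero (s≤s (s≤s (s≤s (s≤s (s≤s {n = t} z≤n))))) 1≤m n≡ =
  ⊥-elim (n≮0 (period-large t m 1≤m (period-equation t m n≡)))
lemma6 .(5 + t) m (suc n) (s≤s (s≤s (s≤s (s≤s (s≤s {n = t} z≤n))))) 1≤m n≡ 𝓕 ν σ =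
  ℚ.≤-trans (½-bound (3 + t) (subst (_≤ weighted t X) (arith t) bound))
            (ℚ.≤-reflexive (sym (weighted-as-ℚ t X)))
  where
  X : ℕ → ℕ
  X = xcount 𝓕 σ (5 + t) m
  bound : 6 + 2 * t ≤ weighted t X
  bound = weighted-xcount-bound t m 1≤m (period-equation t m n≡) 𝓕 ν σ
  arith : ∀ t → 6 + 2 * t ≡ 2 * (3 + t)
  arith = solve-∀
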